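{- Let $p,q$ be distinct odd primes, let $m$ be a positive integer coprime to $pq$, and let $\alpha,\beta$ be positive integers. Then $$\sum_{\substack{i+j+k=mp^{\alpha}q^{\beta}\\ i,j,k\in\mathcal{P}_{pq}}}\frac{1}{ijk}\equiv m\,Z(p^{\alpha}q^{\beta})\pmod{p^{\alpha}}.$$
   Context: For a positive integer $n$, $\mathcal{P}_n$ denotes the set of positive integers coprime to $n$, and $Z(n)=\sum_{i+j+k=n,\ i,j,k\in\mathcal{P}_n}\frac{1}{ijk}$, the sum over ordered triples of positive integers. All sums are over ordered triples $(i,j,k)$ of positive integers. A congruence between rational numbers modulo $p^{\alpha}$ means that the difference, written in lowest terms, has numerator divisible by $p^{\alpha}$ and denominator coprime to $p$. -}

module Defs where

open import Data.Nat as ℕ using (ℕ; zero; suc; _+_; _*_; _∸_; _^_)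
open import Data.Nat.Coprimality using (Coprime; coprime?)
open import Data.Nat.Divisibility using (_∣_)
open import Data.Integer as ℤ using (ℤ; +_)
open import Data.List using (List; []; _∷_; upTo; map; concatMap; foldr)
open import Data.Rational as ℚ using (ℚ; 0ℚ; _/_; _-_; ↥_; ↧ₙ_)
open import Relation.Nullary using (yes; no)

inv3 : ℕ → ℕ → ℕ → ℚ
inv3 a b c = (+ 1) / (suc a * suc b * suc c)

termP : ℕ → ℕ → ℕ → ℕ → ℚ
termP n i j k with coprime? i n | coprime? j n | coprime? k n
... | yes _ | yes _ | yes _ with i | j | k
...   | suc a | suc b | suc c = inv3 a b c
...   | _ | _ | _ = 0ℚ
termP n i j k | _ | _ | _ = 0ℚ

-- S N n = sum over ordered triples (i,j,k) of positive integers with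
-- i + j + k = N and i, j, k ∈ 𝒫_n of 1/(ijk).
-- Enumeration: i = a+1, j = b+1, k = N ∸ i ∸ j, with a + b + 2 < N (so k ≥ 1).
S : ℕ → ℕ → ℚ
S N n = foldr ℚ._+_ 0ℚ
  (concatMap (λ a → map (λ b → termP n (suc a) (suc b) (N ∸ suc a ∸ suc b))
                        (upTo (N ∸ 2 ∸ a)))
             (upTo (N ∸ 2)))

Z : ℕ → ℚ
Z n = S n n

-- congruence of rationals modulo M: the difference in lowest terms has
-- numerator divisible by M and denominator coprime to p
-- (ℚ values are always in lowest terms)
CongMod : ℕ → ℕ → ℚ → ℚ → Set
CongMod p α x y = (p ^ α) ∣ ℤ.∣ ↥ (x - y) ∣ × Coprime (↧ₙ (x - y)) p
  where open import Data.Product using (_×_)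

{-# OPTIONS --safe #-}
module Submission where

-- Work in ℤ₍ₚ₎ modulo p^α. Let h i = 1/i for i ∈ 𝒫_pq and h i = 0 otherwise, and
-- N = p^α q^β. As p^α ∣ N and p ∤ ab, h is N-periodic (1/a − 1/(a+N) = N/(a(a+N))) and
-- odd (1/a + 1/b = (a+b)/(ab), so h a + h b ≡ 0 when N ∣ a + b); also 2 is invertible.
-- For T = h ⋆ (h ⋆ h), splitting off the terms whose first index is below N gives
-- T (s + N) = wrap (h ⋆ h) s + T s, and periodicity gives
-- wrap (h ⋆ h) (s + N) = wrap (wrap h) s + wrap (h ⋆ h) s with wrap (wrap h) N-periodic.
-- The double sum wrap (wrap h) 0 is turned into its own negative by the reflection
-- (i , j) ↦ (N − i , N − j), so it vanishes, whence T (m N) = m · wrap (h ⋆ h) 0 = m · T N.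
-- As h 0 = 0, T s only sees positive indices, i.e. it is S s pq; and 𝒫_N = 𝒫_pq gives
-- Z N = S N pq.

open import Algebra.Bundles using (CommutativeRing)
open import Data.Nat as ℕ using (ℕ; zero; suc; _∸_; _^_; _≤_; _<_; _≥_; z≤n; s≤s)
import Data.Nat.Properties as ℕₚ
open import Data.Nat.Divisibility as ÷ using (_∣_)
open import Data.Nat.Coprimality as Coprimality using (Coprime; coprime?)
open import Data.Nat.Primality using (Prime; euclidsLemma; prime⇒irreducible; prime⇒nonTrivial)
open import Data.Integer as ℤ using (ℤ; +_)
import Data.Integer.Properties as ℤₚ
open import Data.Integer.Tactic.RingSolver using (solve-∀)
open import Data.Rational as ℚ using (ℚ; 0ℚ; 1ℚ; toℚᵘ; _/_)
import Data.Rational.Properties as ℚₚ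
open import Data.Rational.Solver using (module +-*-Solver)
open import Data.Rational.Unnormalised as ℚᵘ using (mkℚᵘ; *≡*; _≃_)
import Data.Rational.Unnormalised.Properties as ℚᵘₚ
open import Data.List using (List; []; _∷_; _++_; map; concatMap; foldr; applyUpTo)
open import Data.Product using (Σ; _,_; proj₁)
open import Data.Sum using (inj₁; inj₂)
open import Data.Empty using (⊥-elim)
open import Function using (_∘_; _$_)
open import Level using (0ℓ)
open import Relation.Nullary using (¬_; yes; no)
import Relation.Binary.PropositionalEquality as ≡
open ≡ using (_≡_; _≢_)
open import Defs using (inv3; termP; S; Z; CongMod)
import Data.Rational

prime∤1 : ∀ {p} → Prime p → ¬ p ∣ 1
prime∤1 p-prime p∣1 = ℕ.nonTrivial⇒≢1 {{prime⇒nonTrivial p-prime}} (÷.∣1⇒≡1 p∣1)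

∣-^ : ∀ a {k} → k ≥ 1 → a ∣ a ^ k
∣-^ a {suc k} _ = ÷.m∣m*n (a ^ k)

coprime-∣ʳ : ∀ {a b c} → b ∣ c → Coprime a c → Coprime a b
coprime-∣ʳ b∣c a⊥c (d∣a , d∣b) = a⊥c (d∣a , ÷.∣-trans d∣b b∣c)

coprime-∣ˡ : ∀ {a b c} → a ∣ b → Coprime b c → Coprime a c
coprime-∣ˡ a∣b b⊥c = Coprimality.sym (coprime-∣ʳ a∣b (Coprimality.sym b⊥c))

coprime-*ʳ : ∀ {a b c} → Coprime a b → Coprime a c → Coprime a (b ℕ.* c)
coprime-*ʳ {a} {b} a⊥b a⊥c {d} (d∣a , d∣bc) = a⊥c (d∣a , Coprimality.coprime-divisor d⊥b d∣bc)
  where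
  d⊥b : Coprime d b
  d⊥b (e∣d , e∣b) = a⊥b (÷.∣-trans e∣d d∣a , e∣b)

coprime-^ʳ : ∀ {a b} k → Coprime a b → Coprime a (b ^ k)
coprime-^ʳ zero    a⊥b (_ , d∣1) = ÷.∣1⇒≡1 d∣1
coprime-^ʳ (suc k) a⊥b = coprime-*ʳ a⊥b (coprime-^ʳ k a⊥b)

coprime-*-^ : ∀ {i a b} α β → Coprime i (a ℕ.* b) → Coprime i (a ^ α ℕ.* b ^ β)
coprime-*-^ {a = a} {b} α β i⊥ab =
  coprime-*ʳ (coprime-^ʳ α (coprime-∣ʳ (÷.m∣m*n b) i⊥ab)) (coprime-^ʳ β (coprime-∣ʳ (÷.n∣m*n a) i⊥ab))

prime∤⇒coprime : ∀ {p n} → Prime p → ¬ p ∣ n → Coprime p n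
prime∤⇒coprime p-prime p∤n (d∣p , d∣n) with prime⇒irreducible p-prime d∣p
... | inj₁ d≡1    = d≡1
... | inj₂ ≡.refl = ⊥-elim (p∤n d∣n)

coprime-+-multiple : ∀ {n L x} → n ∣ L → Coprime x n → Coprime (x ℕ.+ L) n
coprime-+-multiple {x = x} n∣L x⊥n {d} (d∣x+L , d∣n) =
  x⊥n (÷.∣m+n∣m⇒∣n (≡.subst (d ∣_) (ℕₚ.+-comm x _) d∣x+L) (÷.∣-trans d∣n n∣L) , d∣n)

coprime-+-multiple⁻¹ : ∀ {n L x} → n ∣ L → Coprime (x ℕ.+ L) n → Coprime x n
coprime-+-multiple⁻¹ n∣L x+L⊥n (d∣x , d∣n) = x+L⊥n (÷.∣m∣n⇒∣m+n d∣x (÷.∣-trans d∣n n∣L) , d∣n)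

coprime-complement : ∀ {n L x y} → n ∣ L → x ℕ.+ y ≡ L → Coprime x n → Coprime y n
coprime-complement {x = x} {y} n∣L x+y≡L x⊥n {d} (d∣y , d∣n) =
  x⊥n (÷.∣m+n∣m⇒∣n (≡.subst (d ∣_) (≡.trans (≡.sym x+y≡L) (ℕₚ.+-comm x y)) (÷.∣-trans d∣n n∣L)) d∣y , d∣n)

coprime⇒prime∤ : ∀ {p n i} → Prime p → p ∣ n → Coprime i n → ¬ p ∣ i
coprime⇒prime∤ p-prime p∣n i⊥n p∣i = prime∤1 p-prime (≡.subst (λ d → d ∣ 1) (≡.sym (i⊥n (p∣i , p∣n))) ÷.∣-refl)

module FiniteSums {c ℓ} (R : CommutativeRing c ℓ) where

  open CommutativeRing R
  open import Algebra.Properties.CommutativeSemigroup +-commutativeSemigroup using (interchange)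
  open import Relation.Binary.Reasoning.Setoid setoid

  sum : ℕ → (ℕ → Carrier) → Carrier
  sum zero    f = 0#
  sum (suc n) f = f 0 + sum n (f ∘ suc)

  sum-cong : ∀ n {f g : ℕ → Carrier} → (∀ i → i < n → f i ≈ g i) → sum n f ≈ sum n g
  sum-cong zero    f≈g = refl
  sum-cong (suc n) f≈g = +-cong (f≈g 0 (s≤s z≤n)) (sum-cong n (λ i i<n → f≈g (suc i) (s≤s i<n)))

  sum-zero : ∀ n {f : ℕ → Carrier} → (∀ i → i < n → f i ≈ 0#) → sum n f ≈ 0#
  sum-zero zero    f≈0 = refl
  sum-zero (suc n) f≈0 = begin
    _ + sum n _ ≈⟨ +-cong (f≈0 0 (s≤s z≤n)) (sum-zero n (λ i i<n → f≈0 (suc i) (s≤s i<n))) ⟩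
    0# + 0#     ≈⟨ +-identityˡ 0# ⟩
    0#          ∎

  sum-distrib-+ : ∀ n (f g : ℕ → Carrier) → sum n (λ i → f i + g i) ≈ sum n f + sum n g
  sum-distrib-+ zero    f g = sym (+-identityˡ 0#)
  sum-distrib-+ (suc n) f g = trans (+-congˡ (sum-distrib-+ n (f ∘ suc) (g ∘ suc))) (interchange _ _ _ _)

  *-distribˡ-sum : ∀ n x (f : ℕ → Carrier) → x * sum n f ≈ sum n (λ i → x * f i)
  *-distribˡ-sum zero    x f = zeroʳ x
  *-distribˡ-sum (suc n) x f = trans (distribˡ x _ _) (+-congˡ (*-distribˡ-sum n x (f ∘ suc)))

  sum-split : ∀ m n (f : ℕ → Carrier) → sum (m ℕ.+ n) f ≈ sum m f + sum n (λ i → f (m ℕ.+ i))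
  sum-split zero    n f = sym (+-identityˡ _)
  sum-split (suc m) n f = trans (+-congˡ (sum-split m n (f ∘ suc))) (sym (+-assoc _ _ _))

  sum-suc : ∀ n (f : ℕ → Carrier) → sum (suc n) f ≈ sum n f + f n
  sum-suc n f = begin
    sum (suc n) f               ≡⟨ ≡.cong (λ k → sum k f) (ℕₚ.+-comm 1 n) ⟩
    sum (n ℕ.+ 1) f             ≈⟨ sum-split n 1 f ⟩
    sum n f + (f (n ℕ.+ 0) + 0#) ≈⟨ +-congˡ (+-identityʳ _) ⟩
    sum n f + f (n ℕ.+ 0)       ≡⟨ ≡.cong (λ k → sum n f + f k) (ℕₚ.+-identityʳ n) ⟩
    sum n f + f n               ∎

  sum-trailing-zeros : ∀ m n (f : ℕ → Carrier) → (∀ i → i < n → f (m ℕ.+ i) ≈ 0#) →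
                       sum (m ℕ.+ n) f ≈ sum m f
  sum-trailing-zeros m n f f≈0 = begin
    sum (m ℕ.+ n) f                     ≈⟨ sum-split m n f ⟩
    sum m f + sum n (λ i → f (m ℕ.+ i)) ≈⟨ +-congˡ (sum-zero n f≈0) ⟩
    sum m f + 0#                        ≈⟨ +-identityʳ _ ⟩
    sum m f                             ∎

  private
    suc-∸-suc : ∀ n i → i < n → suc (n ∸ suc i) ≡ n ∸ i
    suc-∸-suc n i i<n = ≡.sym (ℕₚ.+-∸-assoc 1 i<n)

  sum-reverse : ∀ n (f : ℕ → Carrier) → sum n f ≈ sum n (λ i → f (n ∸ suc i))
  sum-reverse zero    f = refl
  sum-reverse (suc n) f = begin
    f 0 + sum n (f ∘ suc)                   ≈⟨ +-congˡ (sum-reverse n (f ∘ suc)) ⟩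
    f 0 + sum n (λ i → f (suc (n ∸ suc i))) ≈⟨ +-comm _ _ ⟩
    sum n (λ i → f (suc (n ∸ suc i))) + f 0 ≈⟨ +-cong (sum-cong n (λ i i<n → reflexive (≡.cong f (suc-∸-suc n i i<n))))
                                                      (reflexive (≡.cong f (≡.sym (ℕₚ.n∸n≡0 n)))) ⟩
    sum n (λ i → f (n ∸ i)) + f (n ∸ n)     ≈⟨ sum-suc n (λ i → f (suc n ∸ suc i)) ⟨
    sum (suc n) (λ i → f (suc n ∸ suc i))   ∎

  -- Both sides equal the sum over 0 ≤ i ≤ n, as the end terms vanish.
  sum-reflect : ∀ n (f : ℕ → Carrier) → f 0 ≈ 0# → f n ≈ 0# → sum n f ≈ sum n (λ i → f (n ∸ i))
  sum-reflect zero    f _   _   = refl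
  sum-reflect (suc n) f f0≈0 fn≈0 = begin
    f 0 + sum n (f ∘ suc)                   ≈⟨ trans (+-congʳ f0≈0) (+-identityˡ _) ⟩
    sum n (f ∘ suc)                         ≈⟨ sum-reverse n (f ∘ suc) ⟩
    sum n (λ i → f (suc (n ∸ suc i)))       ≈⟨ sum-cong n (λ i i<n → reflexive (≡.cong f (suc-∸-suc n i i<n))) ⟩
    sum n (λ i → f (n ∸ i))                 ≈⟨ trans (+-congʳ fn≈0) (+-identityˡ _) ⟨
    f (suc n) + sum n (λ i → f (n ∸ i))     ∎

  foldr-+-++ : ∀ (xs ys : List Carrier) → foldr _+_ 0# (xs ++ ys) ≈ foldr _+_ 0# xs + foldr _+_ 0# ys
  foldr-+-++ []       ys = sym (+-identityˡ _)
  foldr-+-++ (x ∷ xs) ys = trans (+-congˡ (foldr-+-++ xs ys)) (sym (+-assoc _ _ _))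

  foldr-+-map-applyUpTo : ∀ n (f : ℕ → ℕ) (g : ℕ → Carrier) →
                          foldr _+_ 0# (map g (applyUpTo f n)) ≈ sum n (g ∘ f)
  foldr-+-map-applyUpTo zero    f g = refl
  foldr-+-map-applyUpTo (suc n) f g = +-congˡ (foldr-+-map-applyUpTo n (f ∘ suc) g)

  foldr-+-concatMap-applyUpTo : ∀ n (f : ℕ → ℕ) (F : ℕ → List Carrier) →
    foldr _+_ 0# (concatMap F (applyUpTo f n)) ≈ sum n (λ a → foldr _+_ 0# (F (f a)))
  foldr-+-concatMap-applyUpTo zero    f F = refl
  foldr-+-concatMap-applyUpTo (suc n) f F =
    trans (foldr-+-++ (F (f 0)) _) (+-congˡ (foldr-+-concatMap-applyUpTo n (f ∘ suc) F))

module Convolution {c ℓ} (R : CommutativeRing c ℓ) where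

  open CommutativeRing R
  open FiniteSums R
  open import Algebra.Properties.Ring ring using (-‿distribˡ-*; -‿distribʳ-*; -‿involutive)
  open import Algebra.Properties.Group +-group using (inverseˡ-unique)
  open import Algebra.Properties.Monoid.Mult +-monoid using (_×_; ×-congʳ)
  open import Algebra.Properties.CommutativeSemigroup ℕₚ.+-commutativeSemigroup using () renaming (interchange to +-interchange)
  open import Relation.Binary.Reasoning.Setoid setoid

  infixl 7 _⋆_
  _⋆_ : (ℕ → Carrier) → (ℕ → Carrier) → ℕ → Carrier
  (f ⋆ g) t = sum (suc t) (λ j → f j * g (t ∸ j))

  neg*neg : ∀ x y → (- x) * (- y) ≈ x * y
  neg*neg x y = begin
    (- x) * (- y)  ≈⟨ -‿distribˡ-* x (- y) ⟨
    - (x * (- y))  ≈⟨ -‿cong (-‿distribʳ-* x y) ⟨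
    - (- (x * y))  ≈⟨ -‿involutive _ ⟩
    x * y          ∎

  triple-product-odd : ∀ {x x′ y y′ z z′} → x + x′ ≈ 0# → y + y′ ≈ 0# → z + z′ ≈ 0# →
                       x * (y * z) + x′ * (y′ * z′) ≈ 0#
  triple-product-odd {x} {x′} {y} {y′} {z} {z′} x+x′≈0 y+y′≈0 z+z′≈0 = begin
    x * (y * z) + x′ * (y′ * z′)                 ≈⟨ +-congʳ (*-cong (inverseˡ-unique x x′ x+x′≈0)
                                                      (*-cong (inverseˡ-unique y y′ y+y′≈0) (inverseˡ-unique z z′ z+z′≈0))) ⟩
    (- x′) * ((- y′) * (- z′)) + x′ * (y′ * z′)  ≈⟨ +-congʳ (*-congˡ (neg*neg y′ z′)) ⟩
    (- x′) * (y′ * z′) + x′ * (y′ * z′)          ≈⟨ +-congʳ (-‿distribˡ-* x′ _) ⟨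
    - (x′ * (y′ * z′)) + x′ * (y′ * z′)          ≈⟨ -‿inverseˡ _ ⟩
    0#                                           ∎

  Periodic : ℕ → (ℕ → Carrier) → Set ℓ
  Periodic N g = ∀ t → g (t ℕ.+ N) ≈ g t

  periodic-multiple : ∀ {N g} → Periodic N g → ∀ l t → g (t ℕ.+ l ℕ.* N) ≈ g t
  periodic-multiple {N} {g} per zero    t = reflexive (≡.cong g (ℕₚ.+-identityʳ t))
  periodic-multiple {N} {g} per (suc l) t = begin
    g (t ℕ.+ (N ℕ.+ l ℕ.* N))  ≡⟨ ≡.cong g (≡.trans (≡.cong (t ℕ.+_) (ℕₚ.+-comm N (l ℕ.* N)))
                                                  (≡.sym (ℕₚ.+-assoc t (l ℕ.* N) N))) ⟩
    g (t ℕ.+ l ℕ.* N ℕ.+ N)    ≈⟨ per _ ⟩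
    g (t ℕ.+ l ℕ.* N)          ≈⟨ periodic-multiple per l t ⟩
    g t                        ∎

  module OddPeriodic (N : ℕ) (h : ℕ → Carrier) (periodic : Periodic N h)
                     (odd : ∀ a b k → a ℕ.+ b ≡ k ℕ.* N → h a + h b ≈ 0#)
                     (halve : ∀ x → x + x ≈ 0# → x ≈ 0#) where

    h0≈0 : h 0 ≈ 0#
    h0≈0 = halve (h 0) (odd 0 0 0 ≡.refl)

    hN≈0 : h N ≈ 0#
    hN≈0 = trans (periodic 0) h0≈0

    wrap : (ℕ → Carrier) → ℕ → Carrier
    wrap g t = sum N (λ j → h j * g (t ℕ.+ N ∸ j))

    ⋆-+N : ∀ g t → (h ⋆ g) (t ℕ.+ N) ≈ wrap g t + (h ⋆ g) t
    ⋆-+N g t = begin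
      (h ⋆ g) (t ℕ.+ N)
        ≡⟨ ≡.cong (λ n → sum n (λ j → h j * g (t ℕ.+ N ∸ j))) suc[t+N]≡N+suc[t] ⟩
      sum (N ℕ.+ suc t) (λ j → h j * g (t ℕ.+ N ∸ j))
        ≈⟨ sum-split N (suc t) _ ⟩
      wrap g t + sum (suc t) (λ i → h (N ℕ.+ i) * g (t ℕ.+ N ∸ (N ℕ.+ i)))
        ≈⟨ +-congˡ (sum-cong (suc t) (λ i _ → *-cong (trans (reflexive (≡.cong h (ℕₚ.+-comm N i))) (periodic i))
                                                     (reflexive (≡.cong g (t+N∸[N+i]≡t∸i i))))) ⟩
      wrap g t + (h ⋆ g) t
        ∎
      where
      suc[t+N]≡N+suc[t] : suc (t ℕ.+ N) ≡ N ℕ.+ suc t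
      suc[t+N]≡N+suc[t] = ≡.trans (≡.cong suc (ℕₚ.+-comm t N)) (≡.sym (ℕₚ.+-suc N t))
      t+N∸[N+i]≡t∸i : ∀ i → t ℕ.+ N ∸ (N ℕ.+ i) ≡ t ∸ i
      t+N∸[N+i]≡t∸i i = ≡.trans (≡.sym (ℕₚ.∸-+-assoc (t ℕ.+ N) N i)) (≡.cong (_∸ i) (ℕₚ.m+n∸n≡m t N))

    wrap-cong : ∀ {g g′} → (∀ t → g t ≈ g′ t) → ∀ t → wrap g t ≈ wrap g′ t
    wrap-cong g≈g′ t = sum-cong N (λ j _ → *-congˡ (g≈g′ _))

    wrap-distrib-+ : ∀ g g′ t → wrap (λ u → g u + g′ u) t ≈ wrap g t + wrap g′ t
    wrap-distrib-+ g g′ t = trans (sum-cong N (λ j _ → distribˡ _ _ _)) (sum-distrib-+ N _ _)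

    wrap-+N : ∀ g t → wrap g (t ℕ.+ N) ≈ wrap (λ u → g (u ℕ.+ N)) t
    wrap-+N g t = sum-cong N (λ j j<N → *-congˡ (reflexive (≡.cong g
      (ℕₚ.+-∸-comm N (ℕₚ.≤-trans (ℕₚ.<⇒≤ j<N) (ℕₚ.m≤n+m N t))))))

    wrap-periodic : ∀ {g} → Periodic N g → Periodic N (wrap g)
    wrap-periodic {g} per t = trans (wrap-+N g t) (wrap-cong per t)

    wrap-⋆-+N : ∀ t → wrap (h ⋆ h) (t ℕ.+ N) ≈ wrap (wrap h) t + wrap (h ⋆ h) t
    wrap-⋆-+N t = begin
      wrap (h ⋆ h) (t ℕ.+ N)               ≈⟨ wrap-+N (h ⋆ h) t ⟩
      wrap (λ u → (h ⋆ h) (u ℕ.+ N)) t     ≈⟨ wrap-cong (⋆-+N h) t ⟩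
      wrap (λ u → wrap h u + (h ⋆ h) u) t  ≈⟨ wrap-distrib-+ (wrap h) (h ⋆ h) t ⟩
      wrap (wrap h) t + wrap (h ⋆ h) t     ∎

    -- The reflection (i , j) ↦ (N ∸ i , N ∸ j) negates every term, since h is odd.
    wrap-wrap-0≈0 : wrap (wrap h) 0 ≈ 0#
    wrap-wrap-0≈0 = halve _ (begin
      wrap (wrap h) 0 + wrap (wrap h) 0
        ≈⟨ +-cong unfold (trans unfold reflect) ⟩
      sum N (λ i → sum N (F i)) + sum N (λ i → sum N (λ j → F (N ∸ i) (N ∸ j)))
        ≈⟨ sum-distrib-+ N _ _ ⟨
      sum N (λ i → sum N (F i) + sum N (λ j → F (N ∸ i) (N ∸ j)))
        ≈⟨ sum-cong N (λ i _ → sum-distrib-+ N _ _) ⟨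
      sum N (λ i → sum N (λ j → F i j + F (N ∸ i) (N ∸ j)))
        ≈⟨ sum-zero N (λ i i<N → sum-zero N (λ j j<N → F-odd (ℕₚ.<⇒≤ i<N) (ℕₚ.<⇒≤ j<N))) ⟩
      0#
        ∎)
      where
      F : ℕ → ℕ → Carrier
      F i j = h i * (h j * h (N ∸ i ℕ.+ (N ∸ j)))

      unfold : wrap (wrap h) 0 ≈ sum N (λ i → sum N (F i))
      unfold = sum-cong N (λ i _ → trans (*-distribˡ-sum N (h i) _) (sum-cong N (λ j j<N →
        *-congˡ (*-congˡ (reflexive (≡.cong h (ℕₚ.+-∸-assoc (N ∸ i) (ℕₚ.<⇒≤ j<N))))))))

      F-0ʳ : ∀ i → F i 0 ≈ 0#
      F-0ʳ i = trans (*-congˡ (trans (*-congʳ h0≈0) (zeroˡ _))) (zeroʳ _)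
      F-Nʳ : ∀ i → F i N ≈ 0#
      F-Nʳ i = trans (*-congˡ (trans (*-congʳ hN≈0) (zeroˡ _))) (zeroʳ _)

      reflect : sum N (λ i → sum N (F i)) ≈ sum N (λ i → sum N (λ j → F (N ∸ i) (N ∸ j)))
      reflect = trans (sum-cong N (λ i _ → sum-reflect N (F i) (F-0ʳ i) (F-Nʳ i)))
                      (sum-reflect N (λ i → sum N (λ j → F i (N ∸ j)))
                        (sum-zero N (λ _ _ → trans (*-congʳ h0≈0) (zeroˡ _)))
                        (sum-zero N (λ _ _ → trans (*-congʳ hN≈0) (zeroˡ _))))

      F-odd : ∀ {i j} → i ≤ N → j ≤ N → F i j + F (N ∸ i) (N ∸ j) ≈ 0#
      F-odd {i} {j} i≤N j≤N = begin
        F i j + F (N ∸ i) (N ∸ j)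
          ≡⟨ ≡.cong₂ (λ a b → F i j + h (N ∸ i) * (h (N ∸ j) * h (a ℕ.+ b)))
                     (ℕₚ.m∸[m∸n]≡n i≤N) (ℕₚ.m∸[m∸n]≡n j≤N) ⟩
        F i j + h (N ∸ i) * (h (N ∸ j) * h (i ℕ.+ j))
          ≈⟨ triple-product-odd (odd i (N ∸ i) 1 (complement i≤N)) (odd j (N ∸ j) 1 (complement j≤N))
                                (odd (N ∸ i ℕ.+ (N ∸ j)) (i ℕ.+ j) 2 double-complement) ⟩
        0#
          ∎
        where
        complement : ∀ {k} → k ≤ N → k ℕ.+ (N ∸ k) ≡ 1 ℕ.* N
        complement k≤N = ≡.trans (ℕₚ.m+[n∸m]≡n k≤N) (≡.sym (ℕₚ.+-identityʳ N))
        double-complement : (N ∸ i ℕ.+ (N ∸ j)) ℕ.+ (i ℕ.+ j) ≡ 2 ℕ.* N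
        double-complement = ≡.trans (+-interchange (N ∸ i) (N ∸ j) i j)
          (≡.cong₂ ℕ._+_ (ℕₚ.m∸n+n≡m i≤N) (≡.trans (ℕₚ.m∸n+n≡m j≤N) (≡.sym (ℕₚ.+-identityʳ N))))

    wrap-⋆-multiple : ∀ l → wrap (h ⋆ h) (l ℕ.* N) ≈ wrap (h ⋆ h) 0
    wrap-⋆-multiple zero    = refl
    wrap-⋆-multiple (suc l) = begin
      wrap (h ⋆ h) (N ℕ.+ l ℕ.* N)                    ≡⟨ ≡.cong (wrap (h ⋆ h)) (ℕₚ.+-comm N (l ℕ.* N)) ⟩
      wrap (h ⋆ h) (l ℕ.* N ℕ.+ N)                    ≈⟨ wrap-⋆-+N (l ℕ.* N) ⟩
      wrap (wrap h) (l ℕ.* N) + wrap (h ⋆ h) (l ℕ.* N) ≈⟨ +-cong wrap-wrap-multiple (wrap-⋆-multiple l) ⟩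
      0# + wrap (h ⋆ h) 0                             ≈⟨ +-identityˡ _ ⟩
      wrap (h ⋆ h) 0                                  ∎
      where
      wrap-wrap-multiple : wrap (wrap h) (l ℕ.* N) ≈ 0#
      wrap-wrap-multiple = trans (periodic-multiple (wrap-periodic (wrap-periodic periodic)) l 0) wrap-wrap-0≈0

    ⋆³-multiple : ∀ l → (h ⋆ (h ⋆ h)) (l ℕ.* N) ≈ l × wrap (h ⋆ h) 0
    ⋆³-multiple zero    = trans (+-identityʳ _) (trans (*-congʳ h0≈0) (zeroˡ _))
    ⋆³-multiple (suc l) = begin
      (h ⋆ (h ⋆ h)) (N ℕ.+ l ℕ.* N)                          ≡⟨ ≡.cong (h ⋆ (h ⋆ h)) (ℕₚ.+-comm N (l ℕ.* N)) ⟩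
      (h ⋆ (h ⋆ h)) (l ℕ.* N ℕ.+ N)                          ≈⟨ ⋆-+N (h ⋆ h) (l ℕ.* N) ⟩
      wrap (h ⋆ h) (l ℕ.* N) + (h ⋆ (h ⋆ h)) (l ℕ.* N)       ≈⟨ +-cong (wrap-⋆-multiple l) (⋆³-multiple l) ⟩
      wrap (h ⋆ h) 0 + l × wrap (h ⋆ h) 0                    ∎

    ⋆³-multiple-of-period : ∀ m → (h ⋆ (h ⋆ h)) (m ℕ.* N) ≈ m × (h ⋆ (h ⋆ h)) N
    ⋆³-multiple-of-period m = begin
      (h ⋆ (h ⋆ h)) (m ℕ.* N)   ≈⟨ ⋆³-multiple m ⟩
      m × wrap (h ⋆ h) 0        ≈⟨ ×-congʳ m (trans (⋆³-multiple 1) (+-identityʳ _)) ⟨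
      m × (h ⋆ (h ⋆ h)) (1 ℕ.* N) ≡⟨ ≡.cong (λ t → m × (h ⋆ (h ⋆ h)) t) (ℕₚ.*-identityˡ N) ⟩
      m × (h ⋆ (h ⋆ h)) N       ∎

  -- Σ h i * h j * h k over i + j + k = s with i, j, k ≥ 1, enumerated by i = a + 1, j = b + 1 as in S.
  positiveTripleSum : (ℕ → Carrier) → ℕ → Carrier
  positiveTripleSum h s =
    sum (s ∸ 2) (λ a → sum (s ∸ 2 ∸ a) (λ b → (h (suc a) * h (suc b)) * h (s ∸ suc a ∸ suc b)))

  positiveTripleSum-cong : ∀ {f g} → (∀ i → f i ≈ g i) → ∀ s → positiveTripleSum f s ≈ positiveTripleSum g s
  positiveTripleSum-cong f≈g s =
    sum-cong (s ∸ 2) (λ a _ → sum-cong (s ∸ 2 ∸ a) (λ b _ → *-cong (*-cong (f≈g _) (f≈g _)) (f≈g _)))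

  module _ (h : ℕ → Carrier) (h0≈0 : h 0 ≈ 0#) where

    ⋆-drop-0 : ∀ g t → (h ⋆ g) t ≈ sum t (λ a → h (suc a) * g (t ∸ suc a))
    ⋆-drop-0 g t = trans (+-congʳ (trans (*-congʳ h0≈0) (zeroˡ _))) (+-identityˡ _)

    ⋆-positive : ∀ t → (h ⋆ h) t ≈ sum (t ∸ 1) (λ b → h (suc b) * h (t ∸ suc b))
    ⋆-positive zero    = ⋆-drop-0 h 0
    ⋆-positive (suc t) = begin
      (h ⋆ h) (suc t)                                                ≈⟨ ⋆-drop-0 h (suc t) ⟩
      sum (suc t) (λ b → h (suc b) * h (t ∸ b))                      ≈⟨ sum-suc t _ ⟩
      sum t (λ b → h (suc b) * h (t ∸ b)) + h (suc t) * h (t ∸ t)    ≈⟨ +-congˡ last≈0 ⟩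
      sum t (λ b → h (suc b) * h (t ∸ b)) + 0#                       ≈⟨ +-identityʳ _ ⟩
      sum t (λ b → h (suc b) * h (t ∸ b))                            ∎
      where
      last≈0 : h (suc t) * h (t ∸ t) ≈ 0#
      last≈0 = trans (*-congˡ (trans (reflexive (≡.cong h (ℕₚ.n∸n≡0 t))) h0≈0)) (zeroʳ _)

    ⋆³≈positiveTripleSum : ∀ s → (h ⋆ (h ⋆ h)) s ≈ positiveTripleSum h s
    ⋆³≈positiveTripleSum s = begin
      (h ⋆ (h ⋆ h)) s
        ≈⟨ ⋆-drop-0 (h ⋆ h) s ⟩
      sum s (λ a → h (suc a) * (h ⋆ h) (s ∸ suc a))
        ≈⟨ sum-cong s (λ a _ → trans (*-congˡ (⋆-positive (s ∸ suc a))) (expand a)) ⟩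
      sum s f
        ≡⟨ ≡.cong (λ n → sum n f) (≡.sym (ℕₚ.m+[n∸m]≡n (ℕₚ.m∸n≤m s 2))) ⟩
      sum (s ∸ 2 ℕ.+ (s ∸ (s ∸ 2))) f
        ≈⟨ sum-trailing-zeros (s ∸ 2) _ f (λ i _ → reflexive (≡.cong (λ n → sum n (g (s ∸ 2 ℕ.+ i)))
                                                               (ℕₚ.m≤n⇒m∸n≡0 (ℕₚ.m≤m+n (s ∸ 2) i)))) ⟩
      positiveTripleSum h s
        ∎
      where
      g : ℕ → ℕ → Carrier
      g a b = (h (suc a) * h (suc b)) * h (s ∸ suc a ∸ suc b)
      f : ℕ → Carrier
      f a = sum (s ∸ 2 ∸ a) (g a)
      s∸[1+a]∸1≡s∸2∸a : ∀ a → s ∸ suc a ∸ 1 ≡ s ∸ 2 ∸ a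
      s∸[1+a]∸1≡s∸2∸a a = ≡.trans (ℕₚ.∸-+-assoc s (suc a) 1)
        (≡.trans (≡.cong (s ∸_) (ℕₚ.+-comm (suc a) 1)) (≡.sym (ℕₚ.∸-+-assoc s 2 a)))
      expand : ∀ a → h (suc a) * sum (s ∸ suc a ∸ 1) (λ b → h (suc b) * h (s ∸ suc a ∸ suc b)) ≈ f a
      expand a = begin
        h (suc a) * sum (s ∸ suc a ∸ 1) (λ b → h (suc b) * h (s ∸ suc a ∸ suc b))
          ≈⟨ *-distribˡ-sum (s ∸ suc a ∸ 1) (h (suc a)) _ ⟩
        sum (s ∸ suc a ∸ 1) (λ b → h (suc a) * (h (suc b) * h (s ∸ suc a ∸ suc b)))
          ≡⟨ ≡.cong (λ n → sum n (λ b → h (suc a) * (h (suc b) * h (s ∸ suc a ∸ suc b)))) (s∸[1+a]∸1≡s∸2∸a a) ⟩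
        sum (s ∸ 2 ∸ a) (λ b → h (suc a) * (h (suc b) * h (s ∸ suc a ∸ suc b)))
          ≈⟨ sum-cong (s ∸ 2 ∸ a) (λ b _ → *-assoc _ _ _) ⟨
        f a
          ∎

module ℚΣ = FiniteSums ℚₚ.+-*-commutativeRing
module ℚ⋆ = Convolution ℚₚ.+-*-commutativeRing

-- 1 / 0 is given the junk value 0.
reciprocal : ℕ → ℚ
reciprocal zero    = 0ℚ
reciprocal (suc a) = + 1 / suc a

reciprocalOn : ℕ → ℕ → ℚ
reciprocalOn n i with coprime? i n
... | yes _ = reciprocal i
... | no  _ = 0ℚ

reciprocalOn-cong : ∀ {n n′} → (∀ {i} → Coprime i n → Coprime i n′) → (∀ {i} → Coprime i n′ → Coprime i n) →
                    ∀ i → reciprocalOn n i ≡ reciprocalOn n′ i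
reciprocalOn-cong {n} {n′} to from i with coprime? i n | coprime? i n′
... | yes _    | yes _     = ≡.refl
... | no  _    | no  _     = ≡.refl
... | yes i⊥n  | no  ¬i⊥n′ = ⊥-elim (¬i⊥n′ (to i⊥n))
... | no  ¬i⊥n | yes i⊥n′  = ⊥-elim (¬i⊥n (from i⊥n′))

inv3≡reciprocal-product : ∀ a b c → inv3 a b c ≡ reciprocal (suc a) ℚ.* reciprocal (suc b) ℚ.* reciprocal (suc c)
inv3≡reciprocal-product a b c = ℚₚ.toℚᵘ-injective (begin
  toℚᵘ (inv3 a b c)                                          ≈⟨ ℚₚ.toℚᵘ-fromℚᵘ (mkℚᵘ (+ 1) _) ⟩
  mkℚᵘ (+ 1) (suc a ℕ.* suc b ℕ.* suc c ℕ.∸ 1)               ≈⟨ *≡* ≡.refl ⟩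
  mkℚᵘ (+ 1) a ℚᵘ.* mkℚᵘ (+ 1) b ℚᵘ.* mkℚᵘ (+ 1) c           ≈⟨ ℚᵘₚ.*-cong (ℚᵘₚ.*-cong (inverse a) (inverse b)) (inverse c) ⟨
  toℚᵘ (reciprocal (suc a)) ℚᵘ.* toℚᵘ (reciprocal (suc b)) ℚᵘ.* toℚᵘ (reciprocal (suc c))
      ≈⟨ ℚᵘₚ.*-cong (ℚₚ.toℚᵘ-homo-* (reciprocal (suc a)) (reciprocal (suc b))) ℚᵘₚ.≃-refl ⟨
  toℚᵘ (reciprocal (suc a) ℚ.* reciprocal (suc b)) ℚᵘ.* toℚᵘ (reciprocal (suc c))
      ≈⟨ ℚₚ.toℚᵘ-homo-* (reciprocal (suc a) ℚ.* reciprocal (suc b)) (reciprocal (suc c)) ⟨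
  toℚᵘ (reciprocal (suc a) ℚ.* reciprocal (suc b) ℚ.* reciprocal (suc c)) ∎)
  where
  open ℚᵘₚ.≃-Reasoning
  inverse : ∀ a → toℚᵘ (reciprocal (suc a)) ≃ mkℚᵘ (+ 1) a
  inverse a = ℚₚ.toℚᵘ-fromℚᵘ (mkℚᵘ (+ 1) a)

private
  0*y*z≡0 : ∀ y z → 0ℚ ℚ.* y ℚ.* z ≡ 0ℚ
  0*y*z≡0 y z = ≡.trans (≡.cong (ℚ._* z) (ℚₚ.*-zeroˡ y)) (ℚₚ.*-zeroˡ z)
  x*0*z≡0 : ∀ x z → x ℚ.* 0ℚ ℚ.* z ≡ 0ℚ
  x*0*z≡0 x z = ≡.trans (≡.cong (ℚ._* z) (ℚₚ.*-zeroʳ x)) (ℚₚ.*-zeroˡ z)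

termP≡reciprocalOn-product : ∀ n i j k → termP n i j k ≡ reciprocalOn n i ℚ.* reciprocalOn n j ℚ.* reciprocalOn n k
termP≡reciprocalOn-product n i j k with coprime? i n | coprime? j n | coprime? k n
termP≡reciprocalOn-product n (suc a) (suc b) (suc c) | yes _ | yes _ | yes _ = inv3≡reciprocal-product a b c
termP≡reciprocalOn-product n zero    j       k       | yes _ | yes _ | yes _ = ≡.sym (0*y*z≡0 (reciprocal j) (reciprocal k))
termP≡reciprocalOn-product n (suc a) zero    k       | yes _ | yes _ | yes _ = ≡.sym (x*0*z≡0 (reciprocal (suc a)) (reciprocal k))
termP≡reciprocalOn-product n (suc a) (suc b) zero    | yes _ | yes _ | yes _ =
  ≡.sym (ℚₚ.*-zeroʳ (reciprocal (suc a) ℚ.* reciprocal (suc b)))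
... | no _  | yes _ | yes _ = ≡.sym (0*y*z≡0 (reciprocal j) (reciprocal k))
... | no _  | yes _ | no _  = ≡.sym (0*y*z≡0 (reciprocal j) 0ℚ)
... | no _  | no _  | yes _ = ≡.sym (0*y*z≡0 0ℚ (reciprocal k))
... | no _  | no _  | no _  = ≡.sym (0*y*z≡0 0ℚ 0ℚ)
... | yes _ | no _  | yes _ = ≡.sym (x*0*z≡0 (reciprocal i) (reciprocal k))
... | yes _ | no _  | no _  = ≡.sym (x*0*z≡0 (reciprocal i) 0ℚ)
... | yes _ | yes _ | no _  = ≡.sym (ℚₚ.*-zeroʳ (reciprocal i ℚ.* reciprocal j))

S≡positiveTripleSum : ∀ s n → S s n ≡ ℚ⋆.positiveTripleSum (reciprocalOn n) s
S≡positiveTripleSum s n =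
  ≡.trans (ℚΣ.foldr-+-concatMap-applyUpTo (s ℕ.∸ 2) (λ i → i) _)
    (ℚΣ.sum-cong (s ℕ.∸ 2) (λ a _ → ≡.trans (ℚΣ.foldr-+-map-applyUpTo (s ℕ.∸ 2 ℕ.∸ a) (λ i → i) _)
      (ℚΣ.sum-cong (s ℕ.∸ 2 ℕ.∸ a) (λ b _ → termP≡reciprocalOn-product n (suc a) (suc b) (s ℕ.∸ suc a ℕ.∸ suc b)))))

S-cong : ∀ {n n′} → (∀ {i} → Coprime i n → Coprime i n′) → (∀ {i} → Coprime i n′ → Coprime i n) →
         ∀ s → S s n ≡ S s n′
S-cong {n} {n′} to from s = begin
  S s n                                          ≡⟨ S≡positiveTripleSum s n ⟩
  ℚ⋆.positiveTripleSum (reciprocalOn n) s        ≡⟨ ℚ⋆.positiveTripleSum-cong (reciprocalOn-cong to from) s ⟩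
  ℚ⋆.positiveTripleSum (reciprocalOn n′) s       ≡⟨ S≡positiveTripleSum s n′ ⟨
  S s n′                                         ∎
  where open ≡.≡-Reasoning

open import Algebra.Properties.Monoid.Mult ℚₚ.+-0-monoid using () renaming (_×_ to _×ℚ_)

suc/1≡1+/1 : ∀ m → + suc m / 1 ≡ 1ℚ ℚ.+ + m / 1
suc/1≡1+/1 m = ℚₚ.toℚᵘ-injective (begin
  toℚᵘ (+ suc m / 1)                       ≈⟨ ℚₚ.toℚᵘ-fromℚᵘ (mkℚᵘ (+ suc m) 0) ⟩
  mkℚᵘ (+ suc m) 0                         ≈⟨ *≡* (eq (+ m)) ⟩
  mkℚᵘ (+ 1) 0 ℚᵘ.+ mkℚᵘ (+ m) 0           ≈⟨ ℚᵘₚ.+-cong ℚᵘₚ.≃-refl (ℚₚ.toℚᵘ-fromℚᵘ (mkℚᵘ (+ m) 0)) ⟨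
  toℚᵘ 1ℚ ℚᵘ.+ toℚᵘ (+ m / 1)              ≈⟨ ℚₚ.toℚᵘ-homo-+ 1ℚ (+ m / 1) ⟨
  toℚᵘ (1ℚ ℚ.+ + m / 1)                    ∎)
  where
  open ℚᵘₚ.≃-Reasoning
  eq : ∀ z → (+ 1 ℤ.+ z) ℤ.* + 1 ≡ (+ 1 ℤ.* + 1 ℤ.+ z ℤ.* + 1) ℤ.* + 1
  eq = solve-∀

×ℚ≡/1* : ∀ m x → m ×ℚ x ≡ (+ m / 1) ℚ.* x
×ℚ≡/1* zero    x = ≡.sym (ℚₚ.*-zeroˡ x)
×ℚ≡/1* (suc m) x = begin
  x ℚ.+ m ×ℚ x                          ≡⟨ ≡.cong (x ℚ.+_) (×ℚ≡/1* m x) ⟩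
  x ℚ.+ (+ m / 1) ℚ.* x                 ≡⟨ ≡.cong (ℚ._+ (+ m / 1) ℚ.* x) (ℚₚ.*-identityˡ x) ⟨
  1ℚ ℚ.* x ℚ.+ (+ m / 1) ℚ.* x          ≡⟨ ℚₚ.*-distribʳ-+ x 1ℚ (+ m / 1) ⟨
  (1ℚ ℚ.+ + m / 1) ℚ.* x                ≡⟨ ≡.cong (ℚ._* x) (suc/1≡1+/1 m) ⟨
  (+ suc m / 1) ℚ.* x                   ∎
  where open ≡.≡-Reasoning

module Localisation (p : ℕ) (p-prime : Prime p) where

  -- M divides x in ℤ₍ₚ₎; mkℚᵘ a d denotes a / (d + 1).
  infix 4 _∣₍ₚ₎_
  record _∣₍ₚ₎_ (M : ℕ) (x : ℚ) : Set where
    constructor witness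
    field
      quotient    : ℤ
      denominator : ℕ
      p∤1+denominator : ¬ p ∣ suc denominator
      x≃M*quotient/1+denominator : toℚᵘ x ≃ mkℚᵘ (+ M ℤ.* quotient) denominator

  Integral : ℚ → Set
  Integral x = 1 ∣₍ₚ₎ x

  p∤* : ∀ {a b} → ¬ p ∣ a → ¬ p ∣ b → ¬ p ∣ a ℕ.* b
  p∤* {a} {b} p∤a p∤b p∣ab with euclidsLemma a b p-prime p∣ab
  ... | inj₁ p∣a = p∤a p∣a
  ... | inj₂ p∣b = p∤b p∣b

  ∣₍ₚ₎-0 : ∀ M → M ∣₍ₚ₎ 0ℚ
  ∣₍ₚ₎-0 M = witness (+ 0) 0 (prime∤1 p-prime) (*≡* (≡.cong (ℤ._* + 1) (≡.sym (ℤₚ.*-zeroʳ (+ M)))))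

  integral-1 : Integral 1ℚ
  integral-1 = witness (+ 1) 0 (prime∤1 p-prime) ℚᵘₚ.≃-refl

  integral-reciprocal : ∀ {a} → ¬ p ∣ suc a → Integral (reciprocal (suc a))
  integral-reciprocal {a} p∤ = witness (+ 1) a p∤ (ℚₚ.toℚᵘ-fromℚᵘ (mkℚᵘ (+ 1) a))

  ∣₍ₚ₎-+ : ∀ {M x y} → M ∣₍ₚ₎ x → M ∣₍ₚ₎ y → M ∣₍ₚ₎ x ℚ.+ y
  ∣₍ₚ₎-+ {M} {x} {y} (witness a d p∤d x≃) (witness b e p∤e y≃) =
    witness (a ℤ.* + suc e ℤ.+ b ℤ.* + suc d) _ (p∤* p∤d p∤e) $
    ℚᵘₚ.≃-trans (ℚₚ.toℚᵘ-homo-+ x y) (ℚᵘₚ.≃-trans (ℚᵘₚ.+-cong x≃ y≃)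
      (ℚᵘₚ.≃-reflexive (≡.cong₂ mkℚᵘ (eq (+ M) a b (+ suc e) (+ suc d)) ≡.refl)))
    where
    eq : ∀ m a b e d → m ℤ.* a ℤ.* e ℤ.+ m ℤ.* b ℤ.* d ≡ m ℤ.* (a ℤ.* e ℤ.+ b ℤ.* d)
    eq = solve-∀

  ∣₍ₚ₎-neg : ∀ {M x} → M ∣₍ₚ₎ x → M ∣₍ₚ₎ ℚ.- x
  ∣₍ₚ₎-neg {M} {x} (witness a d p∤d x≃) = witness (ℤ.- a) d p∤d $
    ℚᵘₚ.≃-trans (ℚₚ.toℚᵘ-homo‿- x) (ℚᵘₚ.≃-trans (ℚᵘₚ.-‿cong x≃)
      (ℚᵘₚ.≃-reflexive (≡.cong₂ mkℚᵘ (eq (+ M) a) ≡.refl)))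
    where
    eq : ∀ m a → ℤ.- (m ℤ.* a) ≡ m ℤ.* ℤ.- a
    eq = solve-∀

  ∣₍ₚ₎-*ʳ : ∀ {M x y} → M ∣₍ₚ₎ x → Integral y → M ∣₍ₚ₎ x ℚ.* y
  ∣₍ₚ₎-*ʳ {M} {x} {y} (witness a d p∤d x≃) (witness b e p∤e y≃) = witness (a ℤ.* b) _ (p∤* p∤d p∤e) $
    ℚᵘₚ.≃-trans (ℚₚ.toℚᵘ-homo-* x y) (ℚᵘₚ.≃-trans (ℚᵘₚ.*-cong x≃ y≃)
      (ℚᵘₚ.≃-reflexive (≡.cong₂ mkℚᵘ (eq (+ M) a b) ≡.refl)))
    where
    eq : ∀ m a b → m ℤ.* a ℤ.* (+ 1 ℤ.* b) ≡ m ℤ.* (a ℤ.* b)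
    eq = solve-∀

  ∣₍ₚ₎-*ˡ : ∀ {M x y} → Integral x → M ∣₍ₚ₎ y → M ∣₍ₚ₎ x ℚ.* y
  ∣₍ₚ₎-*ˡ {M} {x} {y} x∈ℤ₍ₚ₎ M∣y = ≡.subst (M ∣₍ₚ₎_) (ℚₚ.*-comm y x) (∣₍ₚ₎-*ʳ M∣y x∈ℤ₍ₚ₎)

  module Modulo (M : ℕ) where

    ℤ₍ₚ₎ : Set
    ℤ₍ₚ₎ = Σ ℚ Integral

    infix 4 _≋_
    record _≋_ (x y : ℤ₍ₚ₎) : Set where
      constructor ≋-intro
      field
        difference : M ∣₍ₚ₎ proj₁ x ℚ.- proj₁ y

    _⊕_ _⊗_ : ℤ₍ₚ₎ → ℤ₍ₚ₎ → ℤ₍ₚ₎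
    (x , x∈) ⊕ (y , y∈) = x ℚ.+ y , ∣₍ₚ₎-+ x∈ y∈
    (x , x∈) ⊗ (y , y∈) = x ℚ.* y , ∣₍ₚ₎-*ʳ x∈ y∈

    ⊖_ : ℤ₍ₚ₎ → ℤ₍ₚ₎
    ⊖ (x , x∈) = ℚ.- x , ∣₍ₚ₎-neg x∈

    open +-*-Solver

    private
      ≋-by : ∀ {x y : ℤ₍ₚ₎} {z} → proj₁ x ℚ.- proj₁ y ≡ z → M ∣₍ₚ₎ z → x ≋ y
      ≋-by eq M∣z = ≋-intro (≡.subst (M ∣₍ₚ₎_) (≡.sym eq) M∣z)

    ≡⇒≋ : ∀ {x y : ℤ₍ₚ₎} → proj₁ x ≡ proj₁ y → x ≋ y
    ≡⇒≋ {x , _} ≡.refl = ≋-by (ℚₚ.+-inverseʳ x) (∣₍ₚ₎-0 M)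

    ≋-sym : ∀ {x y} → x ≋ y → y ≋ x
    ≋-sym {x , _} {y , _} (≋-intro x≋y) = ≋-by (eq x y) (∣₍ₚ₎-neg x≋y)
      where
      eq : ∀ x y → y ℚ.- x ≡ ℚ.- (x ℚ.- y)
      eq = solve 2 (λ x y → y :- x := :- (x :- y)) ≡.refl

    ≋-trans : ∀ {x y z} → x ≋ y → y ≋ z → x ≋ z
    ≋-trans {x , _} {y , _} {z , _} (≋-intro x≋y) (≋-intro y≋z) = ≋-by (eq x y z) (∣₍ₚ₎-+ x≋y y≋z)
      where
      eq : ∀ x y z → x ℚ.- z ≡ (x ℚ.- y) ℚ.+ (y ℚ.- z)
      eq = solve 3 (λ x y z → x :- z := (x :- y) :+ (y :- z)) ≡.refl

    ⊕-cong : ∀ {x y u v} → x ≋ y → u ≋ v → x ⊕ u ≋ y ⊕ v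
    ⊕-cong {x , _} {y , _} {u , _} {v , _} (≋-intro x≋y) (≋-intro u≋v) = ≋-by (eq x u y v) (∣₍ₚ₎-+ x≋y u≋v)
      where
      eq : ∀ x u y v → (x ℚ.+ u) ℚ.- (y ℚ.+ v) ≡ (x ℚ.- y) ℚ.+ (u ℚ.- v)
      eq = solve 4 (λ x u y v → (x :+ u) :- (y :+ v) := (x :- y) :+ (u :- v)) ≡.refl

    ⊗-cong : ∀ {x y u v} → x ≋ y → u ≋ v → x ⊗ u ≋ y ⊗ v
    ⊗-cong {x , x∈} {y , _} {u , _} {v , v∈} (≋-intro x≋y) (≋-intro u≋v) =
      ≋-by (eq x u y v) (∣₍ₚ₎-+ (∣₍ₚ₎-*ˡ x∈ u≋v) (∣₍ₚ₎-*ʳ x≋y v∈))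
      where
      eq : ∀ x u y v → x ℚ.* u ℚ.- y ℚ.* v ≡ x ℚ.* (u ℚ.- v) ℚ.+ (x ℚ.- y) ℚ.* v
      eq = solve 4 (λ x u y v → x :* u :- y :* v := x :* (u :- v) :+ (x :- y) :* v) ≡.refl

    ⊖-cong : ∀ {x y} → x ≋ y → ⊖ x ≋ ⊖ y
    ⊖-cong {x , _} {y , _} (≋-intro x≋y) = ≋-by (eq x y) (∣₍ₚ₎-neg x≋y)
      where
      eq : ∀ x y → ℚ.- x ℚ.- ℚ.- y ≡ ℚ.- (x ℚ.- y)
      eq = solve 2 (λ x y → :- x :- :- y := :- (x :- y)) ≡.refl

    ℤ₍ₚ₎/M : CommutativeRing 0ℓ 0ℓ
    ℤ₍ₚ₎/M = record
      { Carrier = ℤ₍ₚ₎ ; _≈_ = _≋_ ; _+_ = _⊕_ ; _*_ = _⊗_ ; -_ = ⊖_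
      ; 0# = 0ℚ , ∣₍ₚ₎-0 1 ; 1# = 1ℚ , integral-1
      ; isCommutativeRing = record
        { isRing = record
          { +-isAbelianGroup = record
            { isGroup = record
              { isMonoid = record
                { isSemigroup = record
                  { isMagma = record
                    { isEquivalence = record { refl = ≡⇒≋ ≡.refl ; sym = ≋-sym ; trans = ≋-trans }
                    ; ∙-cong = ⊕-cong }
                  ; assoc = λ x y z → ≡⇒≋ (ℚₚ.+-assoc (proj₁ x) (proj₁ y) (proj₁ z)) }
                ; identity = (λ x → ≡⇒≋ (ℚₚ.+-identityˡ (proj₁ x))) , (λ x → ≡⇒≋ (ℚₚ.+-identityʳ (proj₁ x))) }
              ; inverse = (λ x → ≡⇒≋ (ℚₚ.+-inverseˡ (proj₁ x))) , (λ x → ≡⇒≋ (ℚₚ.+-inverseʳ (proj₁ x)))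
              ; ⁻¹-cong = ⊖-cong }
            ; comm = λ x y → ≡⇒≋ (ℚₚ.+-comm (proj₁ x) (proj₁ y)) }
          ; *-cong = ⊗-cong
          ; *-assoc = λ x y z → ≡⇒≋ (ℚₚ.*-assoc (proj₁ x) (proj₁ y) (proj₁ z))
          ; *-identity = (λ x → ≡⇒≋ (ℚₚ.*-identityˡ (proj₁ x))) , (λ x → ≡⇒≋ (ℚₚ.*-identityʳ (proj₁ x)))
          ; distrib = (λ x y z → ≡⇒≋ (ℚₚ.*-distribˡ-+ (proj₁ x) (proj₁ y) (proj₁ z)))
                    , (λ x y z → ≡⇒≋ (ℚₚ.*-distribʳ-+ (proj₁ x) (proj₁ y) (proj₁ z))) }
        ; *-comm = λ x y → ≡⇒≋ (ℚₚ.*-comm (proj₁ x) (proj₁ y)) } }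

    open CommutativeRing ℤ₍ₚ₎/M using (0#)

    halve : p ≢ 2 → ∀ x → x ⊕ x ≋ 0# → x ≋ 0#
    halve p≢2 (x , _) (≋-intro 2x≋0) = ≋-by (eq x) (∣₍ₚ₎-*ˡ ½∈ℤ₍ₚ₎ 2x≋0)
      where
      p∤2 : ¬ p ∣ 2
      p∤2 p∣2 = p≢2 (ℕₚ.≤-antisym (÷.∣⇒≤ p∣2) (ℕ.nonTrivial⇒n>1 p {{prime⇒nonTrivial p-prime}}))
      ½∈ℤ₍ₚ₎ : Integral (reciprocal 2)
      ½∈ℤ₍ₚ₎ = integral-reciprocal p∤2
      eq : ∀ x → x ℚ.- 0ℚ ≡ (+ 1 / 2) ℚ.* ((x ℚ.+ x) ℚ.- 0ℚ)
      eq = solve 1 (λ x → x :- con 0ℚ := con (+ 1 / 2) :* ((x :+ x) :- con 0ℚ)) ≡.refl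

    open Convolution ℤ₍ₚ₎/M using (positiveTripleSum)
    open import Algebra.Properties.Monoid.Mult (CommutativeRing.+-monoid ℤ₍ₚ₎/M) using (_×_)
    private module Σ₍ₚ₎ = FiniteSums ℤ₍ₚ₎/M

    proj₁-sum : ∀ k f → proj₁ (Σ₍ₚ₎.sum k f) ≡ ℚΣ.sum k (proj₁ ∘ f)
    proj₁-sum zero    f = ≡.refl
    proj₁-sum (suc k) f = ≡.cong (proj₁ (f 0) ℚ.+_) (proj₁-sum k (f ∘ suc))

    proj₁-positiveTripleSum : ∀ f s → proj₁ (positiveTripleSum f s) ≡ ℚ⋆.positiveTripleSum (proj₁ ∘ f) s
    proj₁-positiveTripleSum f s =
      ≡.trans (proj₁-sum (s ℕ.∸ 2) _) (ℚΣ.sum-cong (s ℕ.∸ 2) (λ a _ → proj₁-sum (s ℕ.∸ 2 ℕ.∸ a) _))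

    proj₁-× : ∀ m x → proj₁ (m × x) ≡ m ×ℚ proj₁ x
    proj₁-× zero    x = ≡.refl
    proj₁-× (suc m) x = ≡.cong (proj₁ x ℚ.+_) (proj₁-× m x)

  ∣₍ₚ₎⇒CongMod : ∀ α x y → p ^ α ∣₍ₚ₎ x ℚ.- y → CongMod p α x y
  ∣₍ₚ₎⇒CongMod α x y = reduced (x ℚ.- y)
    where
    open import Data.Product using (_×_)
    reduced : ∀ z → p ^ α ∣₍ₚ₎ z → p ^ α ∣ ℤ.∣ ℚ.↥ z ∣ × Coprime (ℚ.↧ₙ z) p
    reduced (ℚ.mkℚ num den num⊥den) (witness a d p∤d (*≡* e)) =
      Coprimality.coprime-divisor pᵅ⊥d
        (≡.subst (p ^ α ∣_) (≡.sym e′) (÷.∣-trans (÷.m∣m*n ℤ.∣ a ∣) (÷.m∣m*n (suc den)))) ,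
      coprime-∣ˡ den∣d (Coprimality.sym p⊥d)
      where
      p⊥d : Coprime p (suc d)
      p⊥d = prime∤⇒coprime p-prime p∤d
      pᵅ⊥d : Coprime (p ^ α) (suc d)
      pᵅ⊥d = Coprimality.sym (coprime-^ʳ α (Coprimality.sym p⊥d))
      e′ : suc d ℕ.* ℤ.∣ num ∣ ≡ p ^ α ℕ.* ℤ.∣ a ∣ ℕ.* suc den
      e′ = begin
        suc d ℕ.* ℤ.∣ num ∣                       ≡⟨ ℕₚ.*-comm (suc d) _ ⟩
        ℤ.∣ num ∣ ℕ.* suc d                       ≡⟨ ℤₚ.abs-* num (+ suc d) ⟨
        ℤ.∣ num ℤ.* + suc d ∣                     ≡⟨ ≡.cong ℤ.∣_∣ e ⟩
        ℤ.∣ (+ (p ^ α) ℤ.* a) ℤ.* + suc den ∣     ≡⟨ ℤₚ.abs-* (+ (p ^ α) ℤ.* a) (+ suc den) ⟩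
        ℤ.∣ + (p ^ α) ℤ.* a ∣ ℕ.* suc den         ≡⟨ ≡.cong (ℕ._* suc den) (ℤₚ.abs-* (+ (p ^ α)) a) ⟩
        p ^ α ℕ.* ℤ.∣ a ∣ ℕ.* suc den             ∎
        where open ≡.≡-Reasoning
      den∣d : suc den ∣ suc d
      den∣d = Coprimality.coprime-divisor (Coprimality.sym (Coprimality.recompute num⊥den))
                (≡.subst (suc den ∣_) (≡.trans (≡.sym e′) (ℕₚ.*-comm (suc d) _)) (÷.n∣m*n (p ^ α ℕ.* ℤ.∣ a ∣)))

  ∣₍ₚ₎-1/-1/ : ∀ {M a b} c → ¬ p ∣ suc a → ¬ p ∣ suc b → + suc b ℤ.- + suc a ≡ + M ℤ.* c →
               M ∣₍ₚ₎ reciprocal (suc a) ℚ.- reciprocal (suc b)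
  ∣₍ₚ₎-1/-1/ {M} {a} {b} c p∤a p∤b eq = witness c _ (p∤* p∤a p∤b) (begin
    toℚᵘ (reciprocal (suc a) ℚ.- reciprocal (suc b))
      ≈⟨ ℚₚ.toℚᵘ-homo-+ (reciprocal (suc a)) (ℚ.- reciprocal (suc b)) ⟩
    toℚᵘ (reciprocal (suc a)) ℚᵘ.+ toℚᵘ (ℚ.- reciprocal (suc b))
      ≈⟨ ℚᵘₚ.+-cong (ℚₚ.toℚᵘ-fromℚᵘ (mkℚᵘ (+ 1) a))
                    (ℚᵘₚ.≃-trans (ℚₚ.toℚᵘ-homo‿- (reciprocal (suc b)))
                                 (ℚᵘₚ.-‿cong (ℚₚ.toℚᵘ-fromℚᵘ (mkℚᵘ (+ 1) b)))) ⟩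
    mkℚᵘ (+ 1) a ℚᵘ.- mkℚᵘ (+ 1) b
      ≈⟨ ℚᵘₚ.≃-reflexive (≡.cong₂ mkℚᵘ (≡.trans (numerator (+ suc a) (+ suc b)) eq) ≡.refl) ⟩
    mkℚᵘ (+ M ℤ.* c) _
      ∎)
    where
    open ℚᵘₚ.≃-Reasoning
    numerator : ∀ u v → + 1 ℤ.* v ℤ.+ ℤ.- (+ 1) ℤ.* u ≡ v ℤ.- u
    numerator = solve-∀

  ∣₍ₚ₎-1/+1/ : ∀ {M a b} c → ¬ p ∣ suc a → ¬ p ∣ suc b → + suc b ℤ.+ + suc a ≡ + M ℤ.* c →
               M ∣₍ₚ₎ reciprocal (suc a) ℚ.+ reciprocal (suc b)
  ∣₍ₚ₎-1/+1/ {M} {a} {b} c p∤a p∤b eq = witness c _ (p∤* p∤a p∤b) (begin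
    toℚᵘ (reciprocal (suc a) ℚ.+ reciprocal (suc b))
      ≈⟨ ℚₚ.toℚᵘ-homo-+ (reciprocal (suc a)) (reciprocal (suc b)) ⟩
    toℚᵘ (reciprocal (suc a)) ℚᵘ.+ toℚᵘ (reciprocal (suc b))
      ≈⟨ ℚᵘₚ.+-cong (ℚₚ.toℚᵘ-fromℚᵘ (mkℚᵘ (+ 1) a)) (ℚₚ.toℚᵘ-fromℚᵘ (mkℚᵘ (+ 1) b)) ⟩
    mkℚᵘ (+ 1) a ℚᵘ.+ mkℚᵘ (+ 1) b
      ≈⟨ ℚᵘₚ.≃-reflexive (≡.cong₂ mkℚᵘ (≡.trans (numerator (+ suc a) (+ suc b)) eq) ≡.refl) ⟩
    mkℚᵘ (+ M ℤ.* c) _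
      ∎)
    where
    open ℚᵘₚ.≃-Reasoning
    numerator : ∀ u v → + 1 ℤ.* v ℤ.+ + 1 ℤ.* u ≡ v ℤ.+ u
    numerator = solve-∀

  module _ {n : ℕ} (p∣n : p ∣ n) where

    private
      p∤ : ∀ {i} → Coprime i n → ¬ p ∣ i
      p∤ = coprime⇒prime∤ p-prime p∣n

    reciprocalOn-integral : ∀ i → Integral (reciprocalOn n i)
    reciprocalOn-integral i with coprime? i n
    reciprocalOn-integral zero    | yes _   = ∣₍ₚ₎-0 1
    reciprocalOn-integral (suc a) | yes i⊥n = integral-reciprocal (p∤ i⊥n)
    reciprocalOn-integral i       | no  _   = ∣₍ₚ₎-0 1

    reciprocalOn-periodic : ∀ {M N} → n ∣ N → M ∣ N → ∀ i → M ∣₍ₚ₎ reciprocalOn n (i ℕ.+ N) ℚ.- reciprocalOn n i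
    reciprocalOn-periodic {M} {N} n∣N (÷.divides Q N≡Q*M) i with coprime? (i ℕ.+ N) n | coprime? i n
    ... | yes i+N⊥n  | no ¬i⊥n  = ⊥-elim (¬i⊥n (coprime-+-multiple⁻¹ n∣N i+N⊥n))
    ... | no ¬i+N⊥n  | yes i⊥n  = ⊥-elim (¬i+N⊥n (coprime-+-multiple n∣N i⊥n))
    ... | no _       | no _     = ≡.subst (M ∣₍ₚ₎_) (≡.sym (ℚₚ.+-inverseʳ 0ℚ)) (∣₍ₚ₎-0 M)
    reciprocalOn-periodic {M} {N} n∣N (÷.divides Q N≡Q*M) zero    | yes _ | yes 0⊥n = ⊥-elim (p∤ 0⊥n (÷._∣0 p))
    reciprocalOn-periodic {M} {N} n∣N (÷.divides Q N≡Q*M) (suc a) | yes a+N⊥n | yes a⊥n =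
      ∣₍ₚ₎-1/-1/ (ℤ.- + Q) (p∤ a+N⊥n) (p∤ a⊥n) (begin
        + suc a ℤ.- + (suc a ℕ.+ N)           ≡⟨ ≡.cong (λ z → + suc a ℤ.- z) (ℤₚ.pos-+ (suc a) N) ⟩
        + suc a ℤ.- (+ suc a ℤ.+ + N)         ≡⟨ ≡.cong (λ z → + suc a ℤ.- (+ suc a ℤ.+ z))
                                                  (≡.trans (≡.cong +_ N≡Q*M) (ℤₚ.pos-* Q M)) ⟩
        + suc a ℤ.- (+ suc a ℤ.+ + Q ℤ.* + M) ≡⟨ eq (+ suc a) (+ Q) (+ M) ⟩
        + M ℤ.* ℤ.- + Q                       ∎)
      where
      open ≡.≡-Reasoning
      eq : ∀ x q m → x ℤ.- (x ℤ.+ q ℤ.* m) ≡ m ℤ.* ℤ.- q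
      eq = solve-∀

    reciprocalOn-odd : ∀ {M N} → n ∣ N → M ∣ N → ∀ a b k → a ℕ.+ b ≡ k ℕ.* N →
                       M ∣₍ₚ₎ reciprocalOn n a ℚ.+ reciprocalOn n b
    reciprocalOn-odd {M} {N} n∣N M∣N a b k a+b≡kN with coprime? a n | coprime? b n
    ... | yes a⊥n | no ¬b⊥n = ⊥-elim (¬b⊥n (coprime-complement (÷.∣-trans n∣N (÷.n∣m*n k)) a+b≡kN a⊥n))
    ... | no ¬a⊥n | yes b⊥n =
      ⊥-elim (¬a⊥n (coprime-complement (÷.∣-trans n∣N (÷.n∣m*n k)) (≡.trans (ℕₚ.+-comm b a) a+b≡kN) b⊥n))
    ... | no _    | no _    = ∣₍ₚ₎-0 M
    reciprocalOn-odd {M} {N} n∣N M∣N zero    b       k a+b≡kN | yes 0⊥n | _       = ⊥-elim (p∤ 0⊥n (÷._∣0 p))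
    reciprocalOn-odd {M} {N} n∣N M∣N (suc a) zero    k a+b≡kN | yes _   | yes 0⊥n = ⊥-elim (p∤ 0⊥n (÷._∣0 p))
    reciprocalOn-odd {M} {N} n∣N (÷.divides Q N≡Q*M) (suc a) (suc b) k a+b≡kN | yes a⊥n | yes b⊥n =
      ∣₍ₚ₎-1/+1/ (+ (k ℕ.* Q)) (p∤ a⊥n) (p∤ b⊥n) (begin
        + suc b ℤ.+ + suc a     ≡⟨ ℤₚ.pos-+ (suc b) (suc a) ⟨
        + (suc b ℕ.+ suc a)     ≡⟨ ≡.cong +_ (≡.trans (ℕₚ.+-comm (suc b) (suc a)) a+b≡kN) ⟩
        + (k ℕ.* N)             ≡⟨ ≡.cong (λ z → + (k ℕ.* z)) N≡Q*M ⟩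
        + (k ℕ.* (Q ℕ.* M))     ≡⟨ ≡.cong +_ (≡.trans (≡.sym (ℕₚ.*-assoc k Q M)) (ℕₚ.*-comm (k ℕ.* Q) M)) ⟩
        + (M ℕ.* (k ℕ.* Q))     ≡⟨ ℤₚ.pos-* M (k ℕ.* Q) ⟩
        + M ℤ.* + (k ℕ.* Q)     ∎)
      where open ≡.≡-Reasoning

  S-multiple : p ≢ 2 → ∀ {α n N} → p ∣ n → n ∣ N → p ^ α ∣ N → ∀ m →
               p ^ α ∣₍ₚ₎ S (m ℕ.* N) n ℚ.- (+ m / 1) ℚ.* S N n
  S-multiple p≢2 {α} {n} {N} p∣n n∣N pᵅ∣N m =
    ≡.subst (p ^ α ∣₍ₚ₎_) (≡.cong₂ ℚ._-_ lhs rhs) (_≋_.difference key)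
    where
    open Modulo (p ^ α)
    open CommutativeRing ℤ₍ₚ₎/M using (0#; _+_; _≈_; sym; trans)
    open Convolution ℤ₍ₚ₎/M
    open import Algebra.Properties.Monoid.Mult (CommutativeRing.+-monoid ℤ₍ₚ₎/M) using (_×_; ×-congʳ)

    ρ : ℕ → ℤ₍ₚ₎
    ρ i = reciprocalOn n i , reciprocalOn-integral p∣n i
    ρ-periodic : Periodic N ρ
    ρ-periodic i = ≋-intro (reciprocalOn-periodic p∣n n∣N pᵅ∣N i)
    ρ-odd : ∀ a b k → a ℕ.+ b ≡ k ℕ.* N → ρ a + ρ b ≈ 0#
    ρ-odd a b k a+b≡kN = ≋-intro (≡.subst (p ^ α ∣₍ₚ₎_) (≡.sym (ℚₚ.+-identityʳ _))
                                          (reciprocalOn-odd p∣n n∣N pᵅ∣N a b k a+b≡kN))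

    open OddPeriodic N ρ ρ-periodic ρ-odd (halve p≢2)

    key : positiveTripleSum ρ (m ℕ.* N) ≈ m × positiveTripleSum ρ N
    key = trans (sym (⋆³≈positiveTripleSum ρ h0≈0 (m ℕ.* N)))
                (trans (⋆³-multiple-of-period m) (×-congʳ m (⋆³≈positiveTripleSum ρ h0≈0 N)))

    lhs : proj₁ (positiveTripleSum ρ (m ℕ.* N)) ≡ S (m ℕ.* N) n
    lhs = ≡.trans (proj₁-positiveTripleSum ρ (m ℕ.* N)) (≡.sym (S≡positiveTripleSum (m ℕ.* N) n))

    rhs : proj₁ (m × positiveTripleSum ρ N) ≡ (+ m / 1) ℚ.* S N n
    rhs = begin
      proj₁ (m × positiveTripleSum ρ N)                 ≡⟨ proj₁-× m _ ⟩
      m ×ℚ proj₁ (positiveTripleSum ρ N)                ≡⟨ ×ℚ≡/1* m _ ⟩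
      (+ m / 1) ℚ.* proj₁ (positiveTripleSum ρ N)       ≡⟨ ≡.cong ((+ m / 1) ℚ.*_) (≡.trans (proj₁-positiveTripleSum ρ N)
                                                                                 (≡.sym (S≡positiveTripleSum N n))) ⟩
      (+ m / 1) ℚ.* S N n                               ∎
      where open ≡.≡-Reasoning

open import Data.Nat using (_*_)

lemma1 : (p q m α β : ℕ) → Prime p → Prime q → p ≢ 2 → q ≢ 2 → p ≢ q →
    m ≥ 1 → Coprime m (p * q) → α ≥ 1 → β ≥ 1 →
    CongMod p α (S (m * p ^ α * q ^ β) (p * q))
    ((+ m / 1) Data.Rational.* Z (p ^ α * q ^ β))
lemma1 p q m α β p-prime _ p≢2 _ _ _ _ α≥1 β≥1 =
  ∣₍ₚ₎⇒CongMod α (S (m * p ^ α * q ^ β) (p * q)) ((+ m / 1) ℚ.* Z N) $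
    ≡.subst₂ (λ s z → p ^ α ∣₍ₚ₎ S s (p * q) ℚ.- (+ m / 1) ℚ.* z)
      (≡.sym (ℕₚ.*-assoc m (p ^ α) (q ^ β)))
      (S-cong (coprime-*-^ α β) (coprime-∣ʳ pq∣N) N)
      (S-multiple p≢2 {α} (÷.m∣m*n q) pq∣N (÷.m∣m*n (q ^ β)) m)
  where
  open Localisation p p-prime
  N : ℕ
  N = p ^ α * q ^ β
  pq∣N : p * q ∣ N
  pq∣N = ÷.*-pres-∣ (∣-^ p α≥1) (∣-^ q β≥1)
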